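{- Let $\mathcal{I}$ be an instance of 3-SAT and let $G=G(\mathcal{I})$ be the graph defined in the context. If $\mathcal{I}$ has a satisfying assignment, then $t$ is the end-vertex (last vertex) of some MNS ordering of $G$.
   Context: Construction of $G(\mathcal{I})$ for a 3-SAT instance $\mathcal{I}$ with variables $x_1,\dots,x_k$ and clauses $c_1,\dots,c_l$ (each clause a disjunction of three literals): the vertex set consists of literal vertices $X=\{x_1,\dots,x_k,\overline{x}_1,\dots,\overline{x}_k\}$, clause vertices $C=\{c_1,\dots,c_l\}$, and three further vertices $s,b,t$. Edges: every pair of distinct literal vertices is adjacent except the pairs $x_i\overline{x}_i$ ($1\le i\le k$); $C$ is an independent set; each clause vertex $c_j$ is adjacent to every literal vertex except the literal vertices corresponding to the literals occurring in clause $c_j$; $b$ is adjacent to all literal vertices; $s$ and $t$ are each adjacent to all literal vertices and all clause vertices; and $bt$ is an edge. There are no other edges. An MNS ordering is an ordering produced by: choose an arbitrary first vertex; at each subsequent step, where the label of an unnumbered vertex $w$ is the set of positions of already numbered neighbours of $w$, number next an unnumbered vertex whose label is maximal under set inclusion among unnumbered vertices (any tie-break allowed). -}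

module Defs where

open import Data.Nat using (ℕ; _+_)
open import Data.Fin using (Fin; _<_; _≤_; fromℕ)
open import Data.Bool using (Bool; true; false)
open import Data.Product using (_×_; Σ; ∃; ∃-syntax; proj₁; proj₂; _,_)
open import Data.Empty using (⊥)
open import Data.Unit using (⊤)
open import Data.Vec using (Vec)
open import Data.Vec.Membership.Propositional using (_∈_; _∉_)
open import Relation.Nullary using (¬_)
open import Relation.Binary.PropositionalEquality using (_≡_; _≢_)
open import Function.Definitions using (Injective; Surjective)

-- A literal over variables x_1..x_k: (variable index, polarity),
-- polarity true = positive literal x_i, false = negated literal ¬x_i.
Literal : ℕ → Set
Literal k = Fin k × Bool

var : ∀ {k} → Literal k → Fin k
var = proj₁

pol : ∀ {k} → Literal k → Bool
pol = proj₂

Clause : ℕ → Set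
Clause k = Vec (Literal k) 3

Instance : ℕ → ℕ → Set
Instance k l = Fin l → Clause k

LitTrue : ∀ {k} → (Fin k → Bool) → Literal k → Set
LitTrue α ℓ = α (var ℓ) ≡ pol ℓ

Satisfies : ∀ {k l} → (Fin k → Bool) → Instance k l → Set
Satisfies α I = ∀ j → ∃[ ℓ ] (ℓ ∈ I j × LitTrue α ℓ)

Satisfiable : ∀ {k l} → Instance k l → Set
Satisfiable {k} I = ∃[ α ] Satisfies {k} α I

data Vertex (k l : ℕ) : Set where
  lit : Literal k → Vertex k l
  cl  : Fin l → Vertex k l
  s b t : Vertex k l

Complementary : ∀ {k} → Literal k → Literal k → Set
Complementary ℓ ℓ′ = var ℓ ≡ var ℓ′ × pol ℓ ≢ pol ℓ′

Adj : ∀ {k l} → Instance k l → Vertex k l → Vertex k l → Set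
Adj I (lit ℓ) (lit ℓ′) = ℓ ≢ ℓ′ × ¬ Complementary ℓ ℓ′
Adj I (lit ℓ) (cl j)   = ℓ ∉ I j
Adj I (cl j)  (lit ℓ)  = ℓ ∉ I j
Adj I (cl _)  (cl _)   = ⊥
Adj I b (lit _) = ⊤
Adj I (lit _) b = ⊤
Adj I s (lit _) = ⊤
Adj I (lit _) s = ⊤
Adj I t (lit _) = ⊤
Adj I (lit _) t = ⊤
Adj I s (cl _)  = ⊤
Adj I (cl _) s  = ⊤
Adj I t (cl _)  = ⊤
Adj I (cl _) t  = ⊤
Adj I b t = ⊤
Adj I t b = ⊤
Adj I _ _ = ⊥

-- number of vertices: 2k literal vertices, l clause vertices, s, b, t
nV : ℕ → ℕ → ℕ
nV k l = 3 + (k + k) + l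

IsOrdering : ∀ {k l} → (Fin (nV k l) → Vertex k l) → Set
IsOrdering σ = Injective _≡_ _≡_ σ × Surjective _≡_ _≡_ σ

Label : ∀ {k l} → Instance k l → (Fin (nV k l) → Vertex k l) →
        Fin (nV k l) → Vertex k l → Fin (nV k l) → Set
Label I σ i w p = p < i × Adj I (σ p) w

_⊂_ : ∀ {n} → (Fin n → Set) → (Fin n → Set) → Set
A ⊂ B = (∀ p → A p → B p) × ∃[ p ] (B p × ¬ A p)

IsMNS : ∀ {k l} → Instance k l → (Fin (nV k l) → Vertex k l) → Set
IsMNS I σ = ∀ i j → i ≤ j → ¬ (Label I σ i (σ i) ⊂ Label I σ i (σ j))

lastPos : ∀ k l → Fin (nV k l)
lastPos k l = fromℕ (2 + (k + k) + l)

IsMNSEndVertex : ∀ {k l} → Instance k l → Vertex k l → Set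
IsMNSEndVertex {k} {l} I v =
  ∃[ σ ] (IsOrdering {k} {l} σ × IsMNS I σ × σ (lastPos k l) ≡ v)

-- Sort the vertices by the key  s < true literals < false literals < b < clauses < t,
-- clauses with fewer distinct literals first.  If the label of a later vertex w strictly
-- contained that of the vertex v being numbered, some earlier u would be adjacent to w but
-- not to v; running through the types of u, v, w, there is then always a vertex of smaller
-- key than v adjacent to v but not to w.  The substantial cases: v a false literal, where the
-- true literal on the variable of w, or a satisfied literal of the clause w, is such a vertex;
-- and v, w clauses, where inclusion of labels reverses inclusion of literal sets and hence
-- the order of their sizes.
module Submission where

open import Defs
open import Data.Bool using (Bool; true; false; if_then_else_)
open import Data.Bool.Properties using (¬-not) renaming (_≟_ to _≟ᵇ_)
open import Data.Fin as Fin using (Fin; cast; splitAt; join; fromℕ) renaming (zero to 0F; suc to 1+)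
open import Data.Fin.Permutation using (cast-id)
import Data.Fin.Properties as Finₚ
open import Data.Fin.Properties using (toℕ-cast; cast-involutive; ≤fromℕ; +↔⊎; splitAt-join; join-splitAt)
open import Data.List using (List; []; _∷_; tabulate; lookup; length; filter)
open import Data.List.Membership.Propositional using () renaming (_∈_ to _∈ˡ_)
open import Data.List.Membership.Propositional.Properties using (∈-tabulate⁺)
open import Data.List.Properties using (length-tabulate; lookup-tabulate; length-filter)
open import Data.List.Relation.Binary.Permutation.Homogeneous using (onIndices)
open import Data.List.Relation.Binary.Permutation.Propositional using (↭⇒↭ₛ)
open import Data.List.Relation.Binary.Permutation.Propositional.Properties using (↭-length)
import Data.List.Relation.Binary.Permutation.Setoid.Properties as ↭ₛ
open import Data.List.Relation.Unary.Any using (here; there)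
open import Data.List.Relation.Unary.Sorted.TotalOrder.Properties using (lookup-mono-≤)
import Data.List.Sort as Sort
open import Data.Nat using (ℕ; suc; _+_; _≤_; _<_; z≤n; s≤s)
open import Data.Nat.Properties
  using (≤-decTotalOrder; +-monoʳ-<; <⇒≤; ≰⇒>; ≤-<-trans; <⇒≱; m≤n⇒m≤1+n)
open import Data.Product using (Σ-syntax; _×_; _,_; proj₂)
open import Data.Product.Properties using (≡-dec)
open import Data.Sum using (_⊎_; inj₁; inj₂; [_,_]′)
open import Data.Unit using (tt)
open import Data.Vec using (_∷_; head)
open import Data.Vec.Membership.Propositional using (_∈_)
import Data.Vec.Membership.DecPropositional as VecMembership
open import Data.Vec.Relation.Unary.Any using () renaming (here to hereᵛ)
open import Function.Base using (_∘_)
open import Function.Bundles using (_↔_; Inverse; mk↔ₛ′; Bijection)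
open import Function.Construct.Composition using (_↔-∘_)
open import Function.Properties.Inverse using (↔⇒⤖)
open import Relation.Binary.Bundles using (DecTotalOrder)
import Relation.Binary.Construct.On as On
open import Relation.Binary.PropositionalEquality
  using (_≡_; _≢_; refl; sym; trans; cong; subst; subst₂; setoid; module ≡-Reasoning)
open import Relation.Nullary using (¬_; Dec; yes; no; does; contradiction)
open import Relation.Nullary.Decidable using (toSum; _×-dec_; ¬?; decidable-stable)
open import Relation.Unary using (Decidable)

open Inverse using (to; from; strictlyInverseˡ; strictlyInverseʳ)

module _ {V : Set} (κ : V → ℕ) where

  KeySorted : ∀ {n} → (Fin n → V) → Set
  KeySorted σ = ∀ {i j} → i Fin.≤ j → κ (σ i) ≤ κ (σ j)

  sortByKey : ∀ {n} → Fin n ↔ V → Σ[ σ ∈ Fin n ↔ V ] KeySorted (to σ)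
  sortByKey {n} e = σ , λ {i} {j} i≤j →
    subst₂ _≤_ (cong κ (sym (σ≗ i))) (cong κ (sym (σ≗ j)))
      (lookup-mono-≤ (DecTotalOrder.totalOrder byKey) (sort-↗ xs) (cast-mono i≤j))
    where
    byKey = On.decTotalOrder ≤-decTotalOrder κ
    open Sort byKey using (sort; sort-↭; sort-↗)
    xs = tabulate (to e)
    ys = sort xs
    ys↭xs = sort-↭ xs
    π = onIndices (↭⇒↭ₛ ys↭xs)
    |xs|≡n = length-tabulate (to e)
    |ys|≡n : length ys ≡ n
    |ys|≡n = trans (↭-length ys↭xs) |xs|≡n
    σ : Fin n ↔ V
    σ = e ↔-∘ (cast-id |xs|≡n ↔-∘ (π ↔-∘ cast-id (sym |ys|≡n)))
    cast-mono : ∀ {i j} → i Fin.≤ j → cast (sym |ys|≡n) i Fin.≤ cast (sym |ys|≡n) j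
    cast-mono {i} {j} = subst₂ _≤_ (sym (toℕ-cast _ i)) (sym (toℕ-cast _ j))
    σ≗ : ∀ i → to σ i ≡ lookup ys (cast (sym |ys|≡n) i)
    σ≗ i = begin
      to e (cast |xs|≡n (to π i′))
        ≡⟨ lookup-tabulate (to e) _ ⟨
      lookup xs (cast (sym |xs|≡n) (cast |xs|≡n (to π i′)))
        ≡⟨ cong (lookup xs) (cast-involutive (sym |xs|≡n) |xs|≡n _) ⟩
      lookup xs (to π i′)
        ≡⟨ ↭ₛ.onIndices-lookup (setoid V) (↭⇒↭ₛ ys↭xs) i′ ⟨
      lookup ys i′
        ∎
      where
      open ≡-Reasoning
      i′ = cast (sym |ys|≡n) i

  keySorted-last : ∀ {n} (σ : Fin (suc n) ↔ V) → KeySorted (to σ) →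
                   ∀ v → (∀ w → w ≡ v ⊎ κ w < κ v) → to σ (fromℕ n) ≡ v
  keySorted-last {n} σ sorted v v-max with v-max (to σ (fromℕ n))
  ... | inj₁ last≡v = last≡v
  ... | inj₂ last<v = contradiction
    (subst (λ z → κ z ≤ κ (to σ (fromℕ n))) (strictlyInverseˡ σ v) (sorted (≤fromℕ (from σ v))))
    (<⇒≱ last<v)

module _ {A : Set} {P Q : A → Set} (P? : Decidable P) (Q? : Decidable Q)
         (P⇒Q : ∀ {x} → P x → Q x) where

  length-filter-mono : ∀ xs → length (filter P? xs) ≤ length (filter Q? xs)
  length-filter-mono [] = z≤n
  length-filter-mono (x ∷ xs) with P? x | Q? x
  ... | yes _  | yes _  = s≤s (length-filter-mono xs)
  ... | yes px | no ¬qx = contradiction (P⇒Q px) ¬qx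
  ... | no _   | yes _  = m≤n⇒m≤1+n (length-filter-mono xs)
  ... | no _   | no _   = length-filter-mono xs

  length-filter-strictMono : ∀ {y xs} → y ∈ˡ xs → Q y → ¬ P y →
                             length (filter P? xs) < length (filter Q? xs)
  length-filter-strictMono {xs = x ∷ xs} y∈ qy ¬py with P? x | Q? x
  ... | yes px | no ¬qx = contradiction (P⇒Q px) ¬qx
  ... | yes px | yes _  with y∈
  ...   | here refl = contradiction px ¬py
  ...   | there y∈′ = s≤s (length-filter-strictMono y∈′ qy ¬py)
  length-filter-strictMono {xs = _ ∷ xs} y∈ qy ¬py | no _ | yes _ with y∈
  ...   | here refl = s≤s (length-filter-mono xs)
  ...   | there y∈′ = m≤n⇒m≤1+n (length-filter-strictMono y∈′ qy ¬py)
  length-filter-strictMono {xs = _ ∷ xs} y∈ qy ¬py | no _ | no ¬qx with y∈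
  ...   | here refl = contradiction qy ¬qx
  ...   | there y∈′ = length-filter-strictMono y∈′ qy ¬py

⊎↔×Bool : {A : Set} → (A ⊎ A) ↔ (A × Bool)
⊎↔×Bool = mk↔ₛ′ [ (_, true) , (_, false) ]′ (λ { (a , true) → inj₁ a ; (a , false) → inj₂ a })
  (λ { (_ , true) → refl ; (_ , false) → refl }) (λ { (inj₁ _) → refl ; (inj₂ _) → refl })

literals↔ : ∀ {k} → Fin (k + k) ↔ Literal k
literals↔ = ⊎↔×Bool ↔-∘ +↔⊎

vertices↔ : ∀ {k l} → Fin (nV k l) ↔ Vertex k l
vertices↔ {k} {l} = mk↔ₛ′ toV fromV toV∘fromV fromV∘toV
  where
  toV : Fin (nV k l) → Vertex k l
  toV 0F = s
  toV (1+ 0F) = b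
  toV (1+ (1+ 0F)) = t
  toV (1+ (1+ (1+ i))) = [ lit ∘ to literals↔ , cl ]′ (splitAt (k + k) i)
  fromV : Vertex k l → Fin (nV k l)
  fromV s = 0F
  fromV b = 1+ 0F
  fromV t = 1+ (1+ 0F)
  fromV (lit ℓ) = 1+ (1+ (1+ (join (k + k) l (inj₁ (from literals↔ ℓ)))))
  fromV (cl j) = 1+ (1+ (1+ (join (k + k) l (inj₂ j))))
  toV∘fromV : ∀ v → toV (fromV v) ≡ v
  toV∘fromV s = refl
  toV∘fromV b = refl
  toV∘fromV t = refl
  toV∘fromV (lit ℓ) rewrite splitAt-join (k + k) l (inj₁ (from literals↔ ℓ)) =
    cong lit (strictlyInverseˡ literals↔ ℓ)
  toV∘fromV (cl j) rewrite splitAt-join (k + k) l (inj₂ j) = refl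
  fromV∘toV : ∀ i → fromV (toV i) ≡ i
  fromV∘toV 0F = refl
  fromV∘toV (1+ 0F) = refl
  fromV∘toV (1+ (1+ 0F)) = refl
  fromV∘toV (1+ (1+ (1+ i))) =
    trans (fromV-code (splitAt (k + k) i)) (cong (1+ ∘ 1+ ∘ 1+) (join-splitAt (k + k) l i))
    where
    fromV-code : ∀ c → fromV ([ lit ∘ to literals↔ , cl ]′ c) ≡ 1+ (1+ (1+ (join (k + k) l c)))
    fromV-code (inj₁ x) =
      cong (λ y → 1+ (1+ (1+ (join (k + k) l (inj₁ y))))) (strictlyInverseʳ (literals↔ {k}) x)
    fromV-code (inj₂ j) = refl

module _ {k l : ℕ} (I : Instance k l) (κ : Vertex k l → ℕ) where

  LowerNeighboursIncluded : Vertex k l → Vertex k l → Set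
  LowerNeighboursIncluded v w = ∀ x → κ x < κ v → Adj I x v → Adj I x w

  -- In a key-sorted ordering: u is an earlier vertex in the label of w but not in that of v,
  -- and every vertex of smaller key than v is numbered before v.
  IsMNSKey : Set
  IsMNSKey = ∀ {u v w} → κ u ≤ κ v → κ v ≤ κ w → u ≢ v → v ≢ w →
             ¬ Adj I u v → Adj I u w → ¬ LowerNeighboursIncluded v w

  keySorted⇒IsMNS : IsMNSKey → (σ : Fin (nV k l) ↔ Vertex k l) → KeySorted κ (to σ) → IsMNS I (to σ)
  keySorted⇒IsMNS isKey σ sorted i j i≤j (label⊆ , p , (p<i , p∼j) , p≁i) with i Finₚ.≟ j
  ... | yes refl = p≁i (p<i , p∼j)
  ... | no i≢j = isKey (sorted (<⇒≤ p<i)) (sorted (<⇒≤ i<j))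
    (Finₚ.<⇒≢ p<i ∘ injective) (i≢j ∘ injective) (λ p∼i → p≁i (p<i , p∼i)) p∼j lower⊆
    where
    injective = Bijection.injective (↔⇒⤖ σ)
    i<j = Finₚ.≤∧≢⇒< i≤j i≢j
    lower⊆ : LowerNeighboursIncluded (to σ i) (to σ j)
    lower⊆ x x<i x∼i = subst (λ y → Adj I y (to σ j)) σq≡x (proj₂ (label⊆ q (q<i , q∼i)))
      where
      q = from σ x
      σq≡x = strictlyInverseˡ σ x
      q<i : q Fin.< i
      q<i = ≰⇒> λ i≤q → <⇒≱ x<i (subst (λ y → κ (to σ i) ≤ κ y) σq≡x (sorted i≤q))
      q∼i = subst (λ y → Adj I y (to σ i)) (sym σq≡x) x∼i

module _ {k : ℕ} where

  _≟ˡ_ : (x y : Literal k) → Dec (x ≡ y)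
  _≟ˡ_ = ≡-dec Finₚ._≟_ _≟ᵇ_

  complementary? : (x y : Literal k) → Dec (Complementary x y)
  complementary? x y = (var x Finₚ.≟ var y) ×-dec ¬? (pol x ≟ᵇ pol y)

  complementary-sym : ∀ {x y : Literal k} → Complementary x y → Complementary y x
  complementary-sym (x≡y , px≢py) = sym x≡y , px≢py ∘ sym

  complementary-unique : ∀ {x y z : Literal k} → Complementary x z → Complementary y z → x ≡ y
  complementary-unique {_ , _} {_ , _} {_ , _} (refl , px≢pz) (refl , py≢pz) =
    cong (_ ,_) (trans (¬-not px≢pz) (sym (¬-not py≢pz)))

  complementary-true : ∀ {α : Fin k → Bool} {x y : Literal k} →
                       Complementary x y → LitTrue α x → ¬ LitTrue α y
  complementary-true {x = _ , _} {_ , _} (refl , px≢py) αx≡px αy≡py = px≢py (trans (sym αx≡px) αy≡py)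

  nonadjacent⇒complementary : ∀ {l} {I : Instance k l} {x y : Literal k} →
                              x ≢ y → ¬ Adj I (lit x) (lit y) → Complementary x y
  nonadjacent⇒complementary {x = x} {y} x≢y x≁y =
    decidable-stable (complementary? x y) (λ ¬c → x≁y (x≢y , ¬c))

  LitTrue? : (α : Fin k → Bool) (ℓ : Literal k) → Dec (LitTrue α ℓ)
  LitTrue? α ℓ = α (var ℓ) ≟ᵇ pol ℓ

module KeyOf {k l : ℕ} (I : Instance k l) (α : Fin k → Bool) where
  open VecMembership (_≟ˡ_ {k}) using (_∈?_)

  allLiterals : List (Literal k)
  allLiterals = tabulate (to literals↔)

  ∈-allLiterals : ∀ ℓ → ℓ ∈ˡ allLiterals
  ∈-allLiterals ℓ =
    subst (_∈ˡ allLiterals) (strictlyInverseˡ literals↔ ℓ) (∈-tabulate⁺ (from literals↔ ℓ))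

  #literals : Clause k → ℕ
  #literals c = length (filter (_∈? c) allLiterals)

  #literals≤ : ∀ c → #literals c ≤ k + k
  #literals≤ c =
    subst (#literals c ≤_) (length-tabulate (to (literals↔ {k}))) (length-filter (_∈? c) allLiterals)

  key : Vertex k l → ℕ
  key s = 0
  key (lit ℓ) = if does (LitTrue? α ℓ) then 1 else 2
  key b = 3
  key (cl j) = 4 + #literals (I j)
  key t = 5 + (k + k)

  key-true : ∀ {ℓ} → LitTrue α ℓ → key (lit ℓ) ≡ 1
  key-true {ℓ} ℓ-true with LitTrue? α ℓ
  ... | yes _ = refl
  ... | no ℓ-false = contradiction ℓ-true ℓ-false

  key-false : ∀ {ℓ} → ¬ LitTrue α ℓ → key (lit ℓ) ≡ 2
  key-false {ℓ} ℓ-false with LitTrue? α ℓ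
  ... | yes ℓ-true = contradiction ℓ-true ℓ-false
  ... | no _ = refl

  key-lit≤2 : ∀ ℓ → key (lit ℓ) ≤ 2
  key-lit≤2 ℓ with LitTrue? α ℓ
  ... | yes _ = s≤s z≤n
  ... | no _ = s≤s (s≤s z≤n)

  0<key-lit : ∀ {ℓ} → 0 < key (lit ℓ)
  0<key-lit {ℓ} with LitTrue? α ℓ
  ... | yes _ = s≤s z≤n
  ... | no _ = s≤s z≤n

  key-lit<b : ∀ {ℓ} → key (lit ℓ) < key b
  key-lit<b {ℓ} = s≤s (key-lit≤2 ℓ)

  key-lit<cl : ∀ {ℓ j} → key (lit ℓ) < key (cl j)
  key-lit<cl {ℓ} = ≤-<-trans (key-lit≤2 ℓ) (s≤s (s≤s (s≤s z≤n)))

  key-true<false : ∀ {x y} → LitTrue α x → ¬ LitTrue α y → key (lit x) < key (lit y)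
  key-true<false x-true y-false =
    subst₂ _<_ (sym (key-true x-true)) (sym (key-false y-false)) (s≤s (s≤s z≤n))

  key-cl<t : ∀ j → key (cl j) < key t
  key-cl<t j = s≤s (s≤s (s≤s (s≤s (s≤s (#literals≤ (I j))))))

  key-t-maximum : ∀ v → v ≡ t ⊎ key v < key t
  key-t-maximum s = inj₂ (s≤s z≤n)
  key-t-maximum (lit ℓ) = inj₂ (≤-<-trans (key-lit≤2 ℓ) (s≤s (s≤s (s≤s z≤n))))
  key-t-maximum b = inj₂ (s≤s (s≤s (s≤s (s≤s z≤n))))
  key-t-maximum (cl j) = inj₂ (key-cl<t j)
  key-t-maximum t = inj₁ refl

  Lower⊆ : Vertex k l → Vertex k l → Set
  Lower⊆ = LowerNeighboursIncluded I key

  isMNSKey-b : ∀ {u w} → key u ≤ key b → key b ≤ key w → u ≢ b → b ≢ w →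
               ¬ Adj I u b → Adj I u w → ¬ Lower⊆ b w
  isMNSKey-b {s} {s} _ _ _ _ _ () _
  isMNSKey-b {s} {b} _ _ _ b≢w _ _ _ = b≢w refl
  isMNSKey-b {s} {t} _ _ _ _ _ () _
  isMNSKey-b {s} {lit _} _ v≤w _ _ _ _ _ = <⇒≱ key-lit<b v≤w
  isMNSKey-b {s} {cl j} _ _ _ _ _ _ lower⊆ = lower⊆ (lit (head (I j))) key-lit<b tt (head∈ (I j))
    where
    head∈ : (c : Clause k) → head c ∈ c
    head∈ (_ ∷ _) = hereᵛ refl
  isMNSKey-b {lit _} _ _ _ _ u≁v _ _ = u≁v tt
  isMNSKey-b {b} _ _ u≢v _ _ _ _ = u≢v refl
  isMNSKey-b {cl _} (s≤s (s≤s (s≤s ()))) _ _ _ _ _ _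
  isMNSKey-b {t} (s≤s (s≤s (s≤s ()))) _ _ _ _ _ _

  isMNSKey-cl : ∀ {u j w} → key u ≤ key (cl j) → key (cl j) ≤ key w → cl j ≢ w →
                ¬ Adj I u (cl j) → Adj I u w → ¬ Lower⊆ (cl j) w
  isMNSKey-cl {w = s} _ () _ _ _ _
  isMNSKey-cl {w = b} _ (s≤s (s≤s (s≤s ()))) _ _ _ _
  isMNSKey-cl {w = lit _} _ v≤w _ _ _ _ = <⇒≱ key-lit<cl v≤w
  isMNSKey-cl {w = t} _ _ _ _ _ lower⊆ = lower⊆ s (s≤s z≤n) tt
  isMNSKey-cl {s} {w = cl _} _ _ _ u≁v _ _ = u≁v tt
  isMNSKey-cl {b} {w = cl _} _ _ _ _ () _
  isMNSKey-cl {cl _} {w = cl _} _ _ _ _ () _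
  isMNSKey-cl {t} {j} {cl _} u≤v _ _ _ _ _ = <⇒≱ (key-cl<t j) u≤v
  isMNSKey-cl {lit ℓ} {j} {cl j′} _ v≤w _ ℓ∈j ℓ∉j′ lower⊆ = <⇒≱ (+-monoʳ-< 4 #j′<#j) v≤w
    where
    j′⊆j : ∀ {x} → x ∈ I j′ → x ∈ I j
    j′⊆j {x} x∈j′ = decidable-stable (x ∈? I j) (λ x∉j → lower⊆ (lit x) key-lit<cl x∉j x∈j′)
    #j′<#j : #literals (I j′) < #literals (I j)
    #j′<#j = length-filter-strictMono (_∈? I j′) (_∈? I j) j′⊆j (∈-allLiterals ℓ)
               (decidable-stable (ℓ ∈? I j) ℓ∈j) ℓ∉j′

  isMNSKey-falseLit : Satisfies α I → ∀ {ℓ′ ℓ w} → ¬ LitTrue α ℓ → key (lit ℓ) ≤ key w →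
                      lit ℓ ≢ w → Complementary ℓ′ ℓ → Adj I (lit ℓ′) w → ¬ Lower⊆ (lit ℓ) w
  isMNSKey-falseLit _ {w = s} _ v≤w _ _ _ _ = <⇒≱ 0<key-lit v≤w
  isMNSKey-falseLit _ {w = b} _ _ _ _ _ lower⊆ = lower⊆ s 0<key-lit tt
  isMNSKey-falseLit _ {w = t} _ _ _ _ _ lower⊆ = lower⊆ s 0<key-lit tt
  -- Splitting on toSum rather than on LitTrue? itself: with-abstracting the decision would
  -- also rewrite key (lit ℓ″) inside v≤w.
  isMNSKey-falseLit _ {ℓ = ℓ} {lit ℓ″} ℓ-false v≤w v≢w _ _ lower⊆ with toSum (LitTrue? α ℓ″)
  ... | inj₁ ℓ″-true = <⇒≱ (key-true<false ℓ″-true ℓ-false) v≤w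
  ... | inj₂ ℓ″-false = proj₂ (lower⊆ (lit x) (key-true<false refl ℓ-false) (x≢ℓ , x≁ℓ)) x∁ℓ″
    where
    x : Literal k
    x = var ℓ″ , α (var ℓ″)
    x∁ℓ″ : Complementary x ℓ″
    x∁ℓ″ = refl , ℓ″-false
    x≢ℓ : x ≢ ℓ
    x≢ℓ x≡ℓ = ℓ-false (subst (LitTrue α) x≡ℓ refl)
    x≁ℓ : ¬ Complementary x ℓ
    x≁ℓ x∁ℓ =
      v≢w (cong lit (complementary-unique (complementary-sym x∁ℓ) (complementary-sym x∁ℓ″)))
  isMNSKey-falseLit sat {ℓ′} {ℓ} {cl j} ℓ-false _ _ ℓ′∁ℓ ℓ′∉j lower⊆ with sat j
  ... | ℓs , ℓs∈j , ℓs-true = ℓ′∉j (subst (_∈ I j) ℓs≡ℓ′ ℓs∈j)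
    where
    ℓs≢ℓ : ℓs ≢ ℓ
    ℓs≢ℓ ℓs≡ℓ = ℓ-false (subst (LitTrue α) ℓs≡ℓ ℓs-true)
    ℓs≁ℓ : ¬ Adj I (lit ℓs) (lit ℓ)
    ℓs≁ℓ ℓs∼ℓ = lower⊆ (lit ℓs) (key-true<false ℓs-true ℓ-false) ℓs∼ℓ ℓs∈j
    ℓs≡ℓ′ : ℓs ≡ ℓ′
    ℓs≡ℓ′ = complementary-unique (nonadjacent⇒complementary {I = I} ℓs≢ℓ ℓs≁ℓ) ℓ′∁ℓ

  isMNSKey-lit : Satisfies α I → ∀ {ℓ′ ℓ w} → key (lit ℓ′) ≤ key (lit ℓ) → key (lit ℓ) ≤ key w →
                 lit ℓ ≢ w → Complementary ℓ′ ℓ → Adj I (lit ℓ′) w → ¬ Lower⊆ (lit ℓ) w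
  isMNSKey-lit sat {ℓ′} {ℓ} u≤v v≤w v≢w ℓ′∁ℓ ℓ′∼w with toSum (LitTrue? α ℓ)
  ... | inj₁ ℓ-true = contradiction u≤v (<⇒≱ (key-true<false ℓ-true ℓ′-false))
    where ℓ′-false = complementary-true (complementary-sym ℓ′∁ℓ) ℓ-true
  ... | inj₂ ℓ-false = isMNSKey-falseLit sat ℓ-false v≤w v≢w ℓ′∁ℓ ℓ′∼w

  isMNSKey : Satisfies α I → IsMNSKey I key
  isMNSKey _ {s} {s} _ _ u≢v _ _ _ _ = u≢v refl
  isMNSKey _ {lit _} {s} _ _ _ _ u≁v _ _ = u≁v tt
  isMNSKey _ {cl _} {s} _ _ _ _ u≁v _ _ = u≁v tt
  isMNSKey _ {b} {s} () _ _ _ _ _ _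
  isMNSKey _ {t} {s} () _ _ _ _ _ _
  isMNSKey _ {v = b} u≤v v≤w u≢v v≢w u≁v u∼w = isMNSKey-b u≤v v≤w u≢v v≢w u≁v u∼w
  isMNSKey _ {v = t} {w} _ v≤w _ v≢w _ _ _ with key-t-maximum w
  ... | inj₁ w≡t = v≢w (sym w≡t)
  ... | inj₂ w<t = <⇒≱ w<t v≤w
  isMNSKey _ {v = cl _} u≤v v≤w _ v≢w u≁v u∼w = isMNSKey-cl u≤v v≤w v≢w u≁v u∼w
  isMNSKey sat {lit _} {lit _} u≤v v≤w u≢v v≢w u≁v u∼w =
    isMNSKey-lit sat u≤v v≤w v≢w (nonadjacent⇒complementary {I = I} (u≢v ∘ cong lit) u≁v) u∼w
  isMNSKey _ {s} {lit _} _ _ _ _ u≁v _ _ = u≁v tt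
  isMNSKey _ {b} {lit _} _ _ _ _ u≁v _ _ = u≁v tt
  isMNSKey _ {t} {lit _} _ _ _ _ u≁v _ _ = u≁v tt
  isMNSKey _ {cl _} {lit _} u≤v _ _ _ _ _ _ = <⇒≱ key-lit<cl u≤v

lemma5 : ∀ (k l : ℕ) (I : Instance k l) → Satisfiable I → IsMNSEndVertex I t
lemma5 k l I (α , sat) =
  let σ , sorted = sortByKey key vertices↔ in
  to σ , Bijection.bijective (↔⇒⤖ σ) , keySorted⇒IsMNS I key (isMNSKey sat) σ sorted ,
  keySorted-last key σ sorted t key-t-maximum
  where open KeyOf I α
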